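{- In $\mathsf{RSLR}$, let $\Gamma;\Delta\vdash t:A$. Then: (1) if $\Gamma=x:\square\mathbf{N},\Theta$, then $\Theta;\Delta\vdash t[x:=n]:A$ for every numeral $n$; (2) if $\Delta=x:\square H,\Theta$ with $H$ a type different from $\mathbf{N}$, and $\Gamma;\Xi\vdash s:H$ where $\Gamma,\Xi<:\square$, then $\Gamma;\Theta,\Xi\vdash t[x:=s]:A$.
   Context: $\mathsf{RSLR}$ types: $A::=\mathbf{N}\mid aA\rightarrow A$ with aspects $a\in\{\square,\blacksquare\}$ ordered by $\square<:\square$, $\square<:\blacksquare$, $\blacksquare<:\blacksquare$; subtyping is the least reflexive transitive relation with $aA\rightarrow C<:bB\rightarrow D$ when $B<:A$, $C<:D$, $b<:a$; a type is $\square$-free if $\square$ does not occur in it. Terms: $t::=x\mid c\mid ts\mid\lambda x:aA.t\mid\mathtt{case}_A\,t\ \mathtt{zero}\ s\ \mathtt{even}\ r\ \mathtt{odd}\ q\mid\mathtt{recursion}_A\,t\,s\,r$, constants $c::=n\mid S_0\mid S_1\mid P\mid\mathtt{rand}$ (numerals $n$), typed $n,\mathtt{rand}:\mathbf{N}$, $S_0,S_1,P:\blacksquare\mathbf{N}\rightarrow\mathbf{N}$; $t[x:=s]$ is capture-avoiding substitution. A context is a finite set of assignments $x:aA$ with distinct variables; $\Gamma,\Delta$ is disjoint union, written $\Gamma;\Delta$ when all types in $\Gamma$ are $\mathbf{N}$; $\Gamma<:a$ means all aspects in $\Gamma$ are $<:a$. Typing rules: $\Gamma\vdash x:A$ if $x:aA\in\Gamma$;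 from $\Gamma\vdash t:A$, $A<:B$ infer $\Gamma\vdash t:B$; from $\Gamma,x:aA\vdash t:B$ infer $\Gamma\vdash\lambda x:aA.t:aA\rightarrow B$; $\Gamma\vdash c:\mathrm{type}(c)$; from $\Gamma;\Delta_1\vdash t:\mathbf{N}$, $\Gamma;\Delta_2\vdash s:A$, $\Gamma;\Delta_3\vdash r:A$, $\Gamma;\Delta_4\vdash q:A$, $A$ $\square$-free, infer $\Gamma;\Delta_1,\Delta_2,\Delta_3,\Delta_4\vdash\mathtt{case}_A\,t\ \mathtt{zero}\ s\ \mathtt{even}\ r\ \mathtt{odd}\ q:A$; from $\Gamma_1;\Delta_1\vdash t:\mathbf{N}$, $\Gamma_1,\Gamma_2;\Delta_2\vdash s:A$, $\Gamma_1,\Gamma_2;\emptyset\vdash r:\square\mathbf{N}\rightarrow\blacksquare A\rightarrow A$, $\Gamma_1,\Delta_1<:\square$, $A$ $\square$-free, infer $\Gamma_1,\Gamma_2;\Delta_1,\Delta_2\vdash\mathtt{recursion}_A\,t\,s\,r:A$; from $\Gamma;\Delta_1\vdash t:aA\rightarrow B$, $\Gamma;\Delta_2\vdash s:A$, $\Gamma,\Delta_2<:a$ infer $\Gamma;\Delta_1,\Delta_2\vdash ts:B$. -}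

module Defs where

open import Data.Nat using (ℕ; zero; suc; _≟_)
open import Data.Product using (_×_; _,_; proj₁)
open import Data.List using (List; []; _∷_; _++_; map)
open import Data.List.Relation.Unary.All using (All)
open import Data.List.Relation.Unary.Unique.Propositional using (Unique)
open import Data.List.Membership.Propositional using (_∈_; _∉_)
open import Data.List.Relation.Binary.Permutation.Propositional using (_↭_)
open import Relation.Nullary using (yes; no)
open import Relation.Binary.PropositionalEquality using (_≡_)

data Aspect : Set where
  □ ■ : Aspect

data _<:ₐ_ : Aspect → Aspect → Set where
  □<:□ : □ <:ₐ □
  □<:■ : □ <:ₐ ■
  ■<:■ : ■ <:ₐ ■

infixr 6 _⟨_⟩⇒_
data Ty : Set where
  N      : Ty
  _⟨_⟩⇒_ : Aspect → Ty → Ty → Ty    -- a ⟨ A ⟩⇒ C  is  aA → C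

data _<:_ : Ty → Ty → Set where
  <:-refl  : ∀ {A} → A <: A
  <:-trans : ∀ {A B C} → A <: B → B <: C → A <: C
  <:-arr   : ∀ {a b A B C D} → B <: A → C <: D → b <:ₐ a →
             (a ⟨ A ⟩⇒ C) <: (b ⟨ B ⟩⇒ D)

data □-free : Ty → Set where
  N-free   : □-free N
  arr-free : ∀ {A B} → □-free A → □-free B → □-free (■ ⟨ A ⟩⇒ B)

-- Terms (locally nameless: bound variables are de Bruijn indices,
-- free variables are names in ℕ; terms are thus identified up to α)

Var : Set
Var = ℕ

data Const : Set where
  num  : ℕ → Const
  S₀ S₁ P rand : Const

type : Const → Ty
type (num n) = N
type S₀      = ■ ⟨ N ⟩⇒ N
type S₁      = ■ ⟨ N ⟩⇒ N
type P       = ■ ⟨ N ⟩⇒ N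
type rand    = N

data Tm : Set where
  bv   : ℕ → Tm
  fv   : Var → Tm
  cst  : Const → Tm
  app  : Tm → Tm → Tm
  lam  : Aspect → Ty → Tm → Tm      -- λ x : aA . t   (body uses bv 0)
  case : Ty → Tm → Tm → Tm → Tm → Tm  -- case_A t zero s even r odd q
  recursion : Ty → Tm → Tm → Tm → Tm

open[_↦_] : ℕ → Tm → Tm → Tm
open[ k ↦ u ] (bv i) with i ≟ k
... | yes _ = u
... | no _  = bv i
open[ k ↦ u ] (fv x) = fv x
open[ k ↦ u ] (cst c) = cst c
open[ k ↦ u ] (app t s) = app (open[ k ↦ u ] t) (open[ k ↦ u ] s)
open[ k ↦ u ] (lam a A t) = lam a A (open[ suc k ↦ u ] t)
open[ k ↦ u ] (case A t s r q) =
  case A (open[ k ↦ u ] t) (open[ k ↦ u ] s) (open[ k ↦ u ] r) (open[ k ↦ u ] q)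
open[ k ↦ u ] (recursion A t s r) =
  recursion A (open[ k ↦ u ] t) (open[ k ↦ u ] s) (open[ k ↦ u ] r)

_[_:=_] : Tm → Var → Tm → Tm
bv i [ x := s ] = bv i
fv y [ x := s ] with y ≟ x
... | yes _ = s
... | no _  = fv y
cst c [ x := s ] = cst c
app t u [ x := s ] = app (t [ x := s ]) (u [ x := s ])
lam a A t [ x := s ] = lam a A (t [ x := s ])
case A t u r q [ x := s ] =
  case A (t [ x := s ]) (u [ x := s ]) (r [ x := s ]) (q [ x := s ])
recursion A t u r [ x := s ] =
  recursion A (t [ x := s ]) (u [ x := s ]) (r [ x := s ])

-- Contexts: finite sets of assignments x : aA with distinct variables,
-- represented as lists (identified up to permutation, keys unique)

Assign : Set
Assign = Var × Aspect × Ty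

Ctx : Set
Ctx = List Assign

dom : Ctx → List Var
dom = map proj₁

ValidCtx : Ctx → Set
ValidCtx Γ = Unique (dom Γ)

-- C is (as a set) the disjoint union of the list of contexts concatenated in L
_≅_ : Ctx → Ctx → Set
C ≅ L = (C ↭ L) × ValidCtx C

-- all types in Γ are N  (the side condition in the notation Γ;Δ)
AllN : Ctx → Set
AllN = All (λ { (_ , _ , A) → A ≡ N })

_<:ᶜ_ : Ctx → Aspect → Set
Γ <:ᶜ a = All (λ { (_ , b , _) → b <:ₐ a }) Γ

-- Typing  C ⊢ t ∶ A.  A context written Γ;Δ in the paper is Γ ++ Δ with AllN Γ.

infix 4 _⊢_∶_
data _⊢_∶_ : Ctx → Tm → Ty → Set where
  ⊢var : ∀ {C x a A} → ValidCtx C → (x , a , A) ∈ C → C ⊢ fv x ∶ A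
  ⊢sub : ∀ {C t A B} → C ⊢ t ∶ A → A <: B → C ⊢ t ∶ B
  ⊢lam : ∀ {Γ a A t B} (L : List Var) →
         (∀ y → y ∉ L → ((y , a , A) ∷ Γ) ⊢ open[ 0 ↦ fv y ] t ∶ B) →
         Γ ⊢ lam a A t ∶ a ⟨ A ⟩⇒ B
  ⊢cst : ∀ {C c} → ValidCtx C → C ⊢ cst c ∶ type c
  ⊢case : ∀ {C Γ Δ₁ Δ₂ Δ₃ Δ₄ t s r q A} → AllN Γ →
          Γ ++ Δ₁ ⊢ t ∶ N → Γ ++ Δ₂ ⊢ s ∶ A → Γ ++ Δ₃ ⊢ r ∶ A → Γ ++ Δ₄ ⊢ q ∶ A →
          □-free A →
          C ≅ (Γ ++ Δ₁ ++ Δ₂ ++ Δ₃ ++ Δ₄) →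
          C ⊢ case A t s r q ∶ A
  ⊢rec : ∀ {C Γ₁ Γ₂ Δ₁ Δ₂ t s r A} → AllN Γ₁ → AllN Γ₂ →
         Γ₁ ++ Δ₁ ⊢ t ∶ N →
         (Γ₁ ++ Γ₂) ++ Δ₂ ⊢ s ∶ A →
         (Γ₁ ++ Γ₂) ++ [] ⊢ r ∶ □ ⟨ N ⟩⇒ (■ ⟨ A ⟩⇒ A) →
         (Γ₁ ++ Δ₁) <:ᶜ □ →
         □-free A →
         C ≅ ((Γ₁ ++ Γ₂) ++ Δ₁ ++ Δ₂) →
         C ⊢ recursion A t s r ∶ A
  ⊢app : ∀ {C Γ Δ₁ Δ₂ t s a A B} → AllN Γ →
         Γ ++ Δ₁ ⊢ t ∶ a ⟨ A ⟩⇒ B → Γ ++ Δ₂ ⊢ s ∶ A →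
         (Γ ++ Δ₂) <:ᶜ a →
         C ≅ (Γ ++ Δ₁ ++ Δ₂) →
         C ⊢ app t s ∶ B

module Submission where

-- The substitution lemma is proved for every context T that is admissible for
-- the context C of t: T contains every entry of C other than x, contains the
-- context D of s as soon as x occurs in C, and may contain anything else.  This
-- form survives the multi-premise rules, whose contexts are split as Γ;Δ₁,…,Δₖ:
-- T is split in the same way, sending each entry of D to the block of x (or to
-- the shared N-part when it already occurs in C) and every extra entry to a block
-- without side conditions.  That D may join any block is where the hypotheses
-- D <: □ and "D is N-typed if x is" are used.  Substituting a fresh variable by
-- itself gives weakening, which types s in every admissible context.  Part (1)
-- is the instance D = ∅, s = n; part (2) the instance D = Γ,Ξ.

open import Defs
open import Data.Nat using (ℕ; zero; suc; _≤_; _<_; _≤?_; _≟_; z≤n; s≤s)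
open import Data.Nat.Properties
  using (≤-refl; ≤-reflexive; ≤-trans; <⇒≤; m≤n⇒m≤1+n; m≤n⇒m<n∨m≡n; 1+n≰n; <-irrefl; 0≢1+n; n≮0; suc-injective)
open import Data.Fin using (Fin; toℕ) renaming (zero to #0; suc to #suc)
open import Data.Product using (_×_; _,_; proj₁; proj₂; ∃)
open import Data.Product.Properties using (≡-dec)
open import Data.Sum using (_⊎_; inj₁; inj₂; [_,_])
open import Data.Empty using (⊥; ⊥-elim)
open import Function using (_∘_; id)
open import Data.List using (List; []; _∷_; _++_; map; filter; concat; lookup; length)
open import Data.List.Properties using (map-++; filter-all; ++-assoc; ++-identityʳ)
open import Data.List.Extrema.Nat using (max; xs≤max)
open import Data.List.Relation.Unary.All as All using (All; []; _∷_)
import Data.List.Relation.Unary.All.Properties as All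
open import Data.List.Relation.Unary.Any using (here; there)
open import Data.List.Relation.Unary.Unique.Propositional using (Unique; []; _∷_)
import Data.List.Relation.Unary.Unique.Propositional.Properties as Unique
open import Data.List.Membership.Propositional using (_∈_; _∉_)
open import Data.List.Membership.Propositional.Properties
  using (∈-map⁺; ∈-++⁺ˡ; ∈-++⁺ʳ; ∈-++⁻; ∈-filter⁺; ∈-filter⁻; ∈-concat⁺′; ∈-lookup)
open import Data.List.Relation.Binary.Subset.Propositional using (_⊆_)
import Data.List.Relation.Binary.Subset.Propositional.Properties as ⊆
open import Data.List.Relation.Binary.Permutation.Propositional
  using (_↭_; ↭-refl; ↭-sym; ↭-trans; ↭-reflexive; prep; ↭⇒↭ₛ)
open import Data.List.Relation.Binary.Permutation.Propositional.Properties
  using (∈-resp-↭; shift)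
import Data.List.Relation.Binary.Permutation.Propositional.Properties as ↭
import Data.List.Relation.Binary.Permutation.Setoid.Properties as ↭ₛ
open import Data.List.Relation.Binary.Sublist.Propositional as Sublist
  using ([]; _∷_; _∷ʳ_) renaming (_⊆_ to _⊑_)
import Data.List.Relation.Binary.Sublist.Propositional.Properties as Sublist
open import Data.List.Relation.Binary.Disjoint.Propositional using (Disjoint)
open import Relation.Nullary using (Dec; yes; no; ¬_)
open import Relation.Nullary.Decidable using (_×-dec_; _⊎-dec_; ¬?)
open import Relation.Binary.Definitions using (DecidableEquality)
open import Relation.Unary using (Decidable)
open import Relation.Binary.PropositionalEquality
  using (_≡_; _≢_; refl; sym; trans; cong; subst; setoid)

module _ {A : Set} where

  Unique-⊑ : {xs ys : List A} → xs ⊑ ys → Unique ys → Unique xs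
  Unique-⊑ [] u = u
  Unique-⊑ (y ∷ʳ σ) (_ ∷ u) = Unique-⊑ σ u
  Unique-⊑ (refl ∷ σ) (p ∷ u) = Sublist.All-resp-⊆ σ p ∷ Unique-⊑ σ u

  ⊑-suffix : (xs ys : List A) → ys ⊑ xs ++ ys
  ⊑-suffix xs ys = Sublist.++⁺ˡ xs (Sublist.⊆-refl {x = ys})

  ⊑-++⁺ : (xs : List A) {ys zs : List A} → ys ⊑ zs → xs ++ ys ⊑ xs ++ zs
  ⊑-++⁺ xs = Sublist.++⁺ (Sublist.⊆-refl {x = xs})

  ++-⊆ : (xs : List A) {ys zs : List A} → xs ⊆ zs → ys ⊆ zs → xs ++ ys ⊆ zs
  ++-⊆ xs xs⊆ ys⊆ z∈ = [ xs⊆ , ys⊆ ] (∈-++⁻ xs z∈)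

  Unique-↭ : {xs ys : List A} → xs ↭ ys → Unique xs → Unique ys
  Unique-↭ σ = ↭ₛ.Unique-resp-↭ (setoid A) (↭⇒↭ₛ σ)

  Unique-++ʳ : (xs : List A) {ys : List A} → Unique (xs ++ ys) → Unique ys
  Unique-++ʳ [] u = u
  Unique-++ʳ (_ ∷ xs) (_ ∷ u) = Unique-++ʳ xs u

  Unique-++-disjoint : (xs : List A) {ys : List A} {z : A} →
                       Unique (xs ++ ys) → z ∈ xs → z ∉ ys
  Unique-++-disjoint (_ ∷ xs) (p ∷ _) (here refl) z∈ys = All.lookup p (∈-++⁺ʳ xs z∈ys) refl
  Unique-++-disjoint (_ ∷ xs) (_ ∷ u) (there z∈xs) = Unique-++-disjoint xs u z∈xs

  Unique-++-++ : (xs : List A) {ys zs : List A} → Unique (xs ++ ys) → Unique (xs ++ zs) →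
                 Disjoint ys zs → Unique (xs ++ ys ++ zs)
  Unique-++-++ [] uy uz dj = Unique.++⁺ uy uz dj
  Unique-++-++ (_ ∷ xs) (py ∷ uy) (pz ∷ uz) dj =
    All.++⁺ (All.++⁻ˡ xs py) (All.++⁺ (All.++⁻ʳ xs py) (All.++⁻ʳ xs pz))
    ∷ Unique-++-++ xs uy uz dj

  filter-↭-++ : {P Q R : A → Set} (P? : Decidable P) (Q? : Decidable Q) (R? : Decidable R) →
    (∀ {y} → P y → Q y ⊎ R y) → (∀ {y} → Q y → P y) → (∀ {y} → R y → P y) →
    (∀ {y} → Q y → ¬ R y) → (xs : List A) → filter P? xs ↭ filter Q? xs ++ filter R? xs
  filter-↭-++ P? Q? R? P⇒Q⊎R Q⇒P R⇒P Q⇒¬R = go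
    where
    go : ∀ xs → filter P? xs ↭ filter Q? xs ++ filter R? xs
    go [] = ↭-refl
    go (y ∷ xs) with P? y | Q? y | R? y
    ... | yes _  | yes _  | no _   = prep y (go xs)
    ... | yes _  | no _   | yes _  = ↭-trans (prep y (go xs)) (↭-sym (shift y _ _))
    ... | no _   | no _   | no _   = go xs
    ... | _      | yes q  | yes r  = ⊥-elim (Q⇒¬R q r)
    ... | yes p  | no ¬q  | no ¬r  = ⊥-elim ([ ¬q , ¬r ] (P⇒Q⊎R p))
    ... | no ¬p  | yes q  | _      = ⊥-elim (¬p (Q⇒P q))
    ... | no ¬p  | _      | yes r  = ⊥-elim (¬p (R⇒P r))

fresh : (L : List ℕ) → ∃ λ y → y ∉ L
fresh L = suc (max 0 L) , λ y∈L → 1+n≰n (All.lookup (xs≤max 0 L) y∈L)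

key : Assign → Var
key = proj₁

aspectOf : Assign → Aspect
aspectOf (_ , a , _) = a

typeOf : Assign → Ty
typeOf (_ , _ , A) = A

dom-++ : (Γ Δ : Ctx) → dom (Γ ++ Δ) ≡ dom Γ ++ dom Δ
dom-++ = map-++ proj₁

valid-↭ : {Γ Δ : Ctx} → Γ ↭ Δ → ValidCtx Γ → ValidCtx Δ
valid-↭ σ = Unique-↭ (↭.map⁺ proj₁ σ)

valid-⊑ : {Γ Δ : Ctx} → Γ ⊑ Δ → ValidCtx Δ → ValidCtx Γ
valid-⊑ σ = Unique-⊑ (Sublist.map⁺ proj₁ σ)

valid⇒Unique : {Γ : Ctx} → ValidCtx Γ → Unique Γ
valid⇒Unique = Unique.map⁻

valid-key-injective : {Γ : Ctx} {e e′ : Assign} → ValidCtx Γ →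
                      e ∈ Γ → e′ ∈ Γ → key e ≡ key e′ → e ≡ e′
valid-key-injective _ (here refl) (here refl) _ = refl
valid-key-injective (p ∷ _) (here refl) (there e′∈) k = ⊥-elim (All.lookup p (∈-map⁺ proj₁ e′∈) k)
valid-key-injective (p ∷ _) (there e∈) (here refl) k = ⊥-elim (All.lookup p (∈-map⁺ proj₁ e∈) (sym k))
valid-key-injective (_ ∷ v) (there e∈) (there e′∈) k = valid-key-injective v e∈ e′∈ k

valid-tail : ∀ {e Γ} → ValidCtx (e ∷ Γ) → ValidCtx Γ
valid-tail (_ ∷ v) = v

valid-++-++ : (Γ : Ctx) {Θ Ξ : Ctx} → ValidCtx (Γ ++ Θ) → ValidCtx (Γ ++ Ξ) →
              Disjoint (dom Θ) (dom Ξ) → ValidCtx (Γ ++ Θ ++ Ξ)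
valid-++-++ Γ {Θ} {Ξ} ΓΘ-valid ΓΞ-valid Θ#Ξ =
  subst Unique (sym (trans (dom-++ Γ (Θ ++ Ξ)) (cong (dom Γ ++_) (dom-++ Θ Ξ))))
    (Unique-++-++ (dom Γ) (subst Unique (dom-++ Γ Θ) ΓΘ-valid) (subst Unique (dom-++ Γ Ξ) ΓΞ-valid) Θ#Ξ)

valid-filter-++ : ∀ {T : Ctx} {P Q : Assign → Set} (P? : Decidable P) (Q? : Decidable Q) →
                  (∀ {e} → P e → ¬ Q e) → ValidCtx T → ValidCtx (filter P? T ++ filter Q? T)
valid-filter-++ {T} P? Q? P⇒¬Q T-valid =
  valid-↭ (filter-↭-++ (λ e → P? e ⊎-dec Q? e) P? Q? id inj₁ inj₂ P⇒¬Q T)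
          (valid-⊑ (Sublist.filter-⊆ (λ e → P? e ⊎-dec Q? e) T) T-valid)

∈-tail : ∀ {e e′ Γ} → e ∈ e′ ∷ Γ → key e ≢ key e′ → e ∈ Γ
∈-tail (here refl) e≢e′ = ⊥-elim (e≢e′ refl)
∈-tail (there e∈) _   = e∈

_≟ᵃ_ : DecidableEquality Aspect
□ ≟ᵃ □ = yes refl
□ ≟ᵃ ■ = no λ ()
■ ≟ᵃ □ = no λ ()
■ ≟ᵃ ■ = yes refl

_≟ᵗ_ : DecidableEquality Ty
N ≟ᵗ N = yes refl
N ≟ᵗ (_ ⟨ _ ⟩⇒ _) = no λ ()
(_ ⟨ _ ⟩⇒ _) ≟ᵗ N = no λ ()
(a ⟨ A ⟩⇒ B) ≟ᵗ (b ⟨ A′ ⟩⇒ B′) with a ≟ᵃ b | A ≟ᵗ A′ | B ≟ᵗ B′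
... | yes refl | yes refl | yes refl = yes refl
... | no a≢b   | _        | _        = no λ { refl → a≢b refl }
... | yes _    | no A≢A′  | _        = no λ { refl → A≢A′ refl }
... | yes _    | yes _    | no B≢B′  = no λ { refl → B≢B′ refl }

_≟ᵉ_ : DecidableEquality Assign
_≟ᵉ_ = ≡-dec _≟_ (≡-dec _≟ᵃ_ _≟ᵗ_)

open import Data.List.Membership.DecPropositional _≟ᵉ_ using (_∈?_)

data Closed (k : ℕ) : Tm → Set where
  bv        : ∀ {i} → i < k → Closed k (bv i)
  fv        : ∀ {y} → Closed k (fv y)
  cst       : ∀ {c} → Closed k (cst c)
  app       : ∀ {t u} → Closed k t → Closed k u → Closed k (app t u)
  lam       : ∀ {a A t} → Closed (suc k) t → Closed k (lam a A t)
  case      : ∀ {A t u r q} → Closed k t → Closed k u → Closed k r → Closed k q →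
              Closed k (case A t u r q)
  recursion : ∀ {A t u r} → Closed k t → Closed k u → Closed k r →
              Closed k (recursion A t u r)

open-Closed : ∀ {k j t} u → Closed k t → k ≤ j → open[ j ↦ u ] t ≡ t
open-Closed {j = j} u (bv {i} i<k) k≤j with i ≟ j
... | yes refl = ⊥-elim (<-irrefl refl (≤-trans i<k k≤j))
... | no _     = refl
open-Closed u fv _ = refl
open-Closed u cst _ = refl
open-Closed u (app ct cu) k≤j
  rewrite open-Closed u ct k≤j | open-Closed u cu k≤j = refl
open-Closed u (lam ct) k≤j
  rewrite open-Closed u ct (s≤s k≤j) = refl
open-Closed u (case ct cu cr cq) k≤j
  rewrite open-Closed u ct k≤j | open-Closed u cu k≤j
        | open-Closed u cr k≤j | open-Closed u cq k≤j = refl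
open-Closed u (recursion ct cu cr) k≤j
  rewrite open-Closed u ct k≤j | open-Closed u cu k≤j | open-Closed u cr k≤j = refl

Closed-open : ∀ {k u} t → Closed k (open[ k ↦ u ] t) → Closed (suc k) t
Closed-open {k} (bv i) c with i ≟ k
... | yes refl = bv ≤-refl
Closed-open {k} (bv i) (bv i<k) | no _ = bv (m≤n⇒m≤1+n i<k)
Closed-open (fv y) _ = fv
Closed-open (cst c) _ = cst
Closed-open (app t u) (app ct cu) = app (Closed-open t ct) (Closed-open u cu)
Closed-open (lam a A t) (lam ct) = lam (Closed-open t ct)
Closed-open (case A t u r q) (case ct cu cr cq) =
  case (Closed-open t ct) (Closed-open u cu) (Closed-open r cr) (Closed-open q cq)
Closed-open (recursion A t u r) (recursion ct cu cr) =
  recursion (Closed-open t ct) (Closed-open u cu) (Closed-open r cr)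

subst-self : ∀ x t → t [ x := fv x ] ≡ t
subst-self x (bv i) = refl
subst-self x (fv y) with y ≟ x
... | yes refl = refl
... | no _     = refl
subst-self x (cst c) = refl
subst-self x (app t u) rewrite subst-self x t | subst-self x u = refl
subst-self x (lam a A t) rewrite subst-self x t = refl
subst-self x (case A t u r q)
  rewrite subst-self x t | subst-self x u | subst-self x r | subst-self x q = refl
subst-self x (recursion A t u r)
  rewrite subst-self x t | subst-self x u | subst-self x r = refl

subst-fv-≢ : ∀ {x y} s → y ≢ x → fv y [ x := s ] ≡ fv y
subst-fv-≢ {x} {y} s y≢x with y ≟ x
... | yes y≡x = ⊥-elim (y≢x y≡x)
... | no _    = refl

open-subst : ∀ {x s u} k t → u [ x := s ] ≡ u → (∀ j → open[ j ↦ u ] s ≡ s) →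
             open[ k ↦ u ] (t [ x := s ]) ≡ (open[ k ↦ u ] t) [ x := s ]
open-subst k (bv i) u-fixed _ with i ≟ k
... | yes _ = sym u-fixed
... | no _  = refl
open-subst {x} k (fv y) _ s-fixed with y ≟ x
... | yes _ = s-fixed k
... | no _  = refl
open-subst k (cst c) _ _ = refl
open-subst k (app t u) uf sf rewrite open-subst k t uf sf | open-subst k u uf sf = refl
open-subst k (lam a A t) uf sf rewrite open-subst (suc k) t uf sf = refl
open-subst k (case A t u r q) uf sf
  rewrite open-subst k t uf sf | open-subst k u uf sf
        | open-subst k r uf sf | open-subst k q uf sf = refl
open-subst k (recursion A t u r) uf sf
  rewrite open-subst k t uf sf | open-subst k u uf sf | open-subst k r uf sf = refl

⊢-valid : ∀ {C t A} → C ⊢ t ∶ A → ValidCtx C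
⊢-valid (⊢var v _) = v
⊢-valid (⊢sub d _) = ⊢-valid d
⊢-valid (⊢lam L body) with ⊢-valid (body _ (proj₂ (fresh L)))
... | _ ∷ v = v
⊢-valid (⊢cst v) = v
⊢-valid (⊢case _ _ _ _ _ _ (_ , v)) = v
⊢-valid (⊢rec _ _ _ _ _ _ _ (_ , v)) = v
⊢-valid (⊢app _ _ _ _ (_ , v)) = v

⊢-Closed : ∀ {C t A} → C ⊢ t ∶ A → Closed 0 t
⊢-Closed (⊢var _ _) = fv
⊢-Closed (⊢sub d _) = ⊢-Closed d
⊢-Closed (⊢lam {t = t} L body) = lam (Closed-open t (⊢-Closed (body _ (proj₂ (fresh L)))))
⊢-Closed (⊢cst _) = cst
⊢-Closed (⊢case _ d₁ d₂ d₃ d₄ _ _) = case (⊢-Closed d₁) (⊢-Closed d₂) (⊢-Closed d₃) (⊢-Closed d₄)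
⊢-Closed (⊢rec _ _ d₁ d₂ d₃ _ _ _) = recursion (⊢-Closed d₁) (⊢-Closed d₂) (⊢-Closed d₃)
⊢-Closed (⊢app _ d₁ d₂ _ _) = app (⊢-Closed d₁) (⊢-Closed d₂)

blockOf : List Ctx → Assign → ℕ
blockOf [] e = 0
blockOf (B ∷ Bs) e with e ∈? B
... | yes _ = 0
... | no _  = suc (blockOf Bs e)

blockOf-lookup : ∀ Bs {e} → Unique (concat Bs) → (i : Fin (length Bs)) →
                 e ∈ lookup Bs i → blockOf Bs e ≡ toℕ i
blockOf-lookup (B ∷ Bs) {e} u #0 e∈B with e ∈? B
... | yes _  = refl
... | no e∉B = ⊥-elim (e∉B e∈B)
blockOf-lookup (B ∷ Bs) {e} u (#suc i) e∈Bᵢ with e ∈? B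
... | yes e∈B = ⊥-elim (Unique-++-disjoint B u e∈B (∈-concat⁺′ e∈Bᵢ (∈-lookup {xs = Bs} i)))
... | no _    = cong suc (blockOf-lookup Bs (Unique-++ʳ B u) i e∈Bᵢ)

lookup-blockOf : ∀ Bs {e} (i : Fin (length Bs)) → blockOf Bs e ≡ toℕ i → e ∈ lookup Bs i
lookup-blockOf (B ∷ Bs) {e} i eq with e ∈? B
lookup-blockOf (B ∷ Bs) #0       eq | yes e∈B = e∈B
lookup-blockOf (B ∷ Bs) (#suc i) eq | yes _   = ⊥-elim (0≢1+n eq)
lookup-blockOf (B ∷ Bs) #0       eq | no _    = ⊥-elim (0≢1+n (sym eq))
lookup-blockOf (B ∷ Bs) (#suc i) eq | no _    = lookup-blockOf Bs i (suc-injective eq)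

<:ₐ-□ : ∀ {b c} → b <:ₐ □ → b <:ₐ c
<:ₐ-□ {c = □} □<:□ = □<:□
<:ₐ-□ {c = ■} □<:□ = □<:■

module Substitution
  (x : Var) (a : Aspect) (H : Ty) (D : Ctx) (s : Tm)
  (s-weaken : ∀ {T} → ValidCtx T → D ⊆ T → T ⊢ s ∶ H)
  (s-closed : Closed 0 s)
  (D<:□ : D <:ᶜ □)
  (D-N : H ≡ N → AllN D)
  where

  xa : Assign
  xa = x , a , H

  record Admissible (C T : Ctx) : Set where
    field
      x-unique : ∀ {e} → e ∈ C → key e ≡ x → e ≡ xa
      shared-N : ∀ {e} → e ∈ C → e ∈ D → key e ≢ x → typeOf e ≡ N
      valid    : ValidCtx T
      keeps    : ∀ {e} → e ∈ C → key e ≢ x → e ∈ T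
      receives : xa ∈ C → D ⊆ T

  record Substitutable (C : Ctx) (t : Tm) (A : Ty) : Set where
    constructor substitutable
    field apply : ∀ {T} → Admissible C T → T ⊢ t [ x := s ] ∶ A
  open Substitutable public

  module Split {C T : Ctx} (adm : Admissible C T) (Γ₀ : Ctx) (Δs : List Ctx)
               (C≅ : C ≅ concat (Γ₀ ∷ Δs)) where
    open Admissible adm

    Bs : List Ctx
    Bs = Γ₀ ∷ Δs

    Bs-unique : Unique (concat Bs)
    Bs-unique = Unique-↭ (proj₁ C≅) (valid⇒Unique (proj₂ C≅))

    block⊆C : ∀ i → lookup Bs i ⊆ C
    block⊆C i e∈ = ∈-resp-↭ (↭-sym (proj₁ C≅)) (∈-concat⁺′ e∈ (∈-lookup {xs = Bs} i))

    shared? : (e : Assign) → Dec (e ∈ C × key e ≢ x)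
    shared? e = e ∈? C ×-dec ¬? (key e ≟ x)

    -- Each entry of T is labelled with the block it is sent to: an entry of C
    -- keeps its block, an entry of D joins the block of x unless it also occurs
    -- in C, in which case it goes to block 0 (the N-part, shared by all
    -- premises).  Other entries get label length Bs and so fall into the last
    -- block, which the rules below choose among those without side conditions.
    label : Assign → ℕ
    label e with e ∈? D | shared? e
    ... | yes _ | yes _ = 0
    ... | yes _ | no _  = blockOf Bs xa
    ... | no _  | _     = blockOf Bs e

    label-kept : ∀ {e} → e ∈ C → key e ≢ x → label e ≡ 0 ⊎ label e ≡ blockOf Bs e
    label-kept {e} e∈C e≢x with e ∈? D | shared? e
    ... | yes _ | yes _  = inj₁ refl
    ... | yes _ | no ¬sh = ⊥-elim (¬sh (e∈C , e≢x))
    ... | no _  | _      = inj₂ refl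

    label-received : ∀ {e} → e ∈ D → label e ≡ 0 ⊎ label e ≡ blockOf Bs xa
    label-received {e} e∈D with e ∈? D | shared? e
    ... | yes _  | yes _ = inj₁ refl
    ... | yes _  | no _  = inj₂ refl
    ... | no e∉D | _     = ⊥-elim (e∉D e∈D)

    data Origin (e : Assign) (i : ℕ) : Set where
      shared   : e ∈ D → e ∈ C → key e ≢ x → Origin e i
      received : e ∈ D → blockOf Bs xa ≡ i → Origin e i
      own      : blockOf Bs e ≡ i → Origin e i

    label-origin : ∀ {e i} → label e ≡ i → Origin e i
    label-origin {e} eq with e ∈? D | shared? e
    ... | yes e∈D | yes (e∈C , e≢x) = shared e∈D e∈C e≢x
    ... | yes e∈D | no _            = received e∈D eq
    ... | no _    | _               = own eq

    piece : ℕ → Ctx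
    piece i = filter (λ e → label e ≟ i) T

    from : ℕ → Ctx
    from k = filter (λ e → k ≤? label e) T

    from-split : ∀ k → from k ↭ piece k ++ from (suc k)
    from-split k = filter-↭-++ (λ e → k ≤? label e) (λ e → label e ≟ k) (λ e → suc k ≤? label e)
      (λ k≤ → [ inj₂ , inj₁ ∘ sym ] (m≤n⇒m<n∨m≡n k≤)) (≤-reflexive ∘ sym) <⇒≤
      (λ ≡k k< → <-irrefl (sym ≡k) k<) T

    layers : ℕ → ℕ → Ctx
    layers k zero    = from k
    layers k (suc n) = piece k ++ layers (suc k) n

    T↭layers : ∀ n → T ↭ layers 0 n
    T↭layers n = subst (_↭ layers 0 n) (filter-all (λ e → 0 ≤? label e) (All.tabulate λ _ → z≤n))
                       (from↭layers 0 n)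
      where
      from↭layers : ∀ k n → from k ↭ layers k n
      from↭layers k zero    = ↭-refl
      from↭layers k (suc n) = ↭-trans (from-split k) (↭.++⁺ˡ (piece k) (from↭layers (suc k) n))

    place-piece : ∀ i {e c} → e ∈ T → c ∈ lookup Bs i → label e ≡ blockOf Bs c → e ∈ piece (toℕ i)
    place-piece i e∈T c∈Bᵢ eq =
      ∈-filter⁺ (λ e → label e ≟ _) e∈T (trans eq (blockOf-lookup Bs Bs-unique i c∈Bᵢ))

    place-from : ∀ i {e c} → e ∈ T → c ∈ lookup Bs i → label e ≡ blockOf Bs c → e ∈ from (toℕ i)
    place-from i e∈T c∈Bᵢ eq =
      ∈-filter⁺ (λ e → _ ≤? label e) e∈T (≤-reflexive (sym (trans eq (blockOf-lookup Bs Bs-unique i c∈Bᵢ))))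

    premise : ∀ {Cₚ Tₚ} → Cₚ ⊆ C → ValidCtx Tₚ → piece 0 ⊆ Tₚ →
              (∀ {e c} → e ∈ T → c ∈ Cₚ → label e ≡ blockOf Bs c → e ∈ Tₚ) →
              Admissible Cₚ Tₚ
    premise {Cₚ} {Tₚ} Cₚ⊆C Tₚ-valid piece₀⊆Tₚ place = record
      { x-unique = λ e∈ → x-unique (Cₚ⊆C e∈)
      ; shared-N = λ e∈ → shared-N (Cₚ⊆C e∈)
      ; valid    = Tₚ-valid
      ; keeps    = λ e∈ e≢x → collect (keeps (Cₚ⊆C e∈) e≢x) e∈ (label-kept (Cₚ⊆C e∈) e≢x)
      ; receives = λ xa∈ e∈D → collect (receives (Cₚ⊆C xa∈) e∈D) xa∈ (label-received e∈D)
      }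
      where
      collect : ∀ {e c} → e ∈ T → c ∈ Cₚ → label e ≡ 0 ⊎ label e ≡ blockOf Bs c → e ∈ Tₚ
      collect e∈T _   (inj₁ ≡0) = piece₀⊆Tₚ (∈-filter⁺ (λ e → label e ≟ 0) e∈T ≡0)
      collect e∈T c∈ (inj₂ eq) = place e∈T c∈ eq

    premise₀ : ∀ i {Tᵢ} → ValidCtx (piece 0 ++ Tᵢ) →
               (∀ {e c} → e ∈ T → c ∈ lookup Δs i → label e ≡ blockOf Bs c → e ∈ Tᵢ) →
               Admissible (Γ₀ ++ lookup Δs i) (piece 0 ++ Tᵢ)
    premise₀ i valid-Tₚ place =
      premise (++-⊆ Γ₀ (block⊆C #0) (block⊆C (#suc i))) valid-Tₚ (⊆.xs⊆xs++ys _ _) place′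
      where
      place′ : ∀ {e c} → e ∈ T → c ∈ Γ₀ ++ lookup Δs i → label e ≡ blockOf Bs c → e ∈ piece 0 ++ _
      place′ e∈T c∈ eq with ∈-++⁻ Γ₀ c∈
      ... | inj₁ c∈Γ₀ = ∈-++⁺ˡ (place-piece #0 e∈T c∈Γ₀ eq)
      ... | inj₂ c∈Δᵢ = ∈-++⁺ʳ (piece 0) (place e∈T c∈Δᵢ eq)

    premise-piece : ∀ i → Admissible (Γ₀ ++ lookup Δs i) (piece 0 ++ piece (suc (toℕ i)))
    premise-piece i = premise₀ i
      (valid-filter-++ (λ e → label e ≟ 0) (λ e → label e ≟ _) (λ ≡0 ≡i → 0≢1+n (trans (sym ≡0) ≡i)) valid)
      (place-piece (#suc i))

    premise-from : ∀ i → Admissible (Γ₀ ++ lookup Δs i) (piece 0 ++ from (suc (toℕ i)))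
    premise-from i = premise₀ i
      (valid-filter-++ (λ e → label e ≟ 0) (λ e → _ ≤? label e) (λ ≡0 i≤ → n≮0 (subst (_ ≤_) ≡0 i≤)) valid)
      (place-from (#suc i))

    piece-origin : ∀ {i e} → e ∈ piece i → Origin e i
    piece-origin {i} e∈ = label-origin (proj₂ (∈-filter⁻ (λ e → label e ≟ i) {xs = T} e∈))

    piece-AllN : ∀ i → AllN (lookup Bs i) → AllN (piece (toℕ i))
    piece-AllN i Bᵢ-N = All.tabulate (by-origin ∘ piece-origin)
      where
      in-block : ∀ {e} → blockOf Bs e ≡ toℕ i → typeOf e ≡ N
      in-block eq = All.lookup Bᵢ-N (lookup-blockOf Bs i eq)
      by-origin : ∀ {e} → Origin e (toℕ i) → typeOf e ≡ N
      by-origin (shared e∈D e∈C e≢x) = shared-N e∈C e∈D e≢x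
      by-origin (received e∈D eq)    = All.lookup (D-N (in-block eq)) e∈D
      by-origin (own eq)             = in-block eq

    piece-<: : ∀ i {b} → lookup Bs i <:ᶜ b → piece (toℕ i) <:ᶜ b
    piece-<: i {b} Bᵢ<:b = All.tabulate (by-origin ∘ piece-origin)
      where
      by-origin : ∀ {e} → Origin e (toℕ i) → aspectOf e <:ₐ b
      by-origin (shared e∈D _ _) = <:ₐ-□ (All.lookup D<:□ e∈D)
      by-origin (received e∈D _) = <:ₐ-□ (All.lookup D<:□ e∈D)
      by-origin (own eq)         = All.lookup Bᵢ<:b (lookup-blockOf Bs i eq)

  subst-app : ∀ {C Γ Δ₁ Δ₂ t u b A B} → AllN Γ →
              Substitutable (Γ ++ Δ₁) t (b ⟨ A ⟩⇒ B) → Substitutable (Γ ++ Δ₂) u A →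
              (Γ ++ Δ₂) <:ᶜ b → C ≅ (Γ ++ Δ₁ ++ Δ₂) → Substitutable C (app t u) B
  subst-app {Γ = Γ} {Δ₁} {Δ₂} Γ-N sub-t sub-u Γ++Δ₂<:b (C↭ , C-valid) .apply {T} adm =
    ⊢app (piece-AllN #0 Γ-N) (apply sub-t (premise-from (#suc #0))) (apply sub-u (premise-piece #0))
      (All.++⁺ (piece-<: #0 (All.++⁻ˡ Γ Γ++Δ₂<:b)) (piece-<: (#suc #0) (All.++⁻ʳ Γ Γ++Δ₂<:b)))
      (↭-trans (T↭layers 2) (↭.++⁺ˡ (piece 0) (↭.++-comm (piece 1) (from 2))) , Admissible.valid adm)
    where
    C↭ΓΔ₂Δ₁ : _ ↭ concat (Γ ∷ Δ₂ ∷ Δ₁ ∷ [])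
    C↭ΓΔ₂Δ₁ = ↭-trans C↭ (↭.++⁺ˡ Γ (↭-trans (↭.++-comm Δ₁ Δ₂) (↭.++⁺ˡ Δ₂ (↭-sym (↭.++-identityʳ Δ₁)))))
    open Split adm Γ (Δ₂ ∷ Δ₁ ∷ []) (C↭ΓΔ₂Δ₁ , C-valid)

  subst-case : ∀ {C Γ Δ₁ Δ₂ Δ₃ Δ₄ t u r q A} → AllN Γ →
               Substitutable (Γ ++ Δ₁) t N → Substitutable (Γ ++ Δ₂) u A →
               Substitutable (Γ ++ Δ₃) r A → Substitutable (Γ ++ Δ₄) q A →
               □-free A → C ≅ (Γ ++ Δ₁ ++ Δ₂ ++ Δ₃ ++ Δ₄) → Substitutable C (case A t u r q) A
  subst-case {Γ = Γ} {Δ₁} {Δ₂} {Δ₃} {Δ₄} Γ-N sub-t sub-u sub-r sub-q A-free (C↭ , C-valid) .apply {T} adm =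
    ⊢case (piece-AllN #0 Γ-N)
      (apply sub-t (premise-piece #0)) (apply sub-u (premise-piece (#suc #0)))
      (apply sub-r (premise-piece (#suc (#suc #0)))) (apply sub-q (premise-from (#suc (#suc (#suc #0)))))
      A-free (T↭layers 4 , Admissible.valid adm)
    where
    open Split adm Γ (Δ₁ ∷ Δ₂ ∷ Δ₃ ∷ Δ₄ ∷ [])
      (↭-trans C↭ (↭-reflexive (cong (λ Δ → Γ ++ Δ₁ ++ Δ₂ ++ Δ₃ ++ Δ) (sym (++-identityʳ Δ₄)))) , C-valid)

  subst-rec : ∀ {C Γ₁ Γ₂ Δ₁ Δ₂ t u r A} → AllN Γ₁ → AllN Γ₂ →
              Substitutable (Γ₁ ++ Δ₁) t N → Substitutable ((Γ₁ ++ Γ₂) ++ Δ₂) u A →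
              Substitutable ((Γ₁ ++ Γ₂) ++ []) r (□ ⟨ N ⟩⇒ (■ ⟨ A ⟩⇒ A)) →
              (Γ₁ ++ Δ₁) <:ᶜ □ → □-free A → C ≅ ((Γ₁ ++ Γ₂) ++ Δ₁ ++ Δ₂) →
              Substitutable C (recursion A t u r) A
  subst-rec {Γ₁ = Γ₁} {Γ₂} {Δ₁} {Δ₂} Γ₁-N Γ₂-N sub-t sub-u sub-r Γ₁++Δ₁<:□ A-free (C↭ , C-valid) .apply {T} adm =
    ⊢rec (piece-AllN #0 Γ₁-N) (piece-AllN (#suc #0) Γ₂-N)
      (apply sub-t (premise-piece (#suc #0)))
      (apply sub-u (premise (++-⊆ (Γ₁ ++ Γ₂) Γ₁++Γ₂⊆C (block⊆C (#suc (#suc (#suc #0)))))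
                      (valid-⊑ (⊑-++⁺ (piece 0 ++ piece 1) (⊑-suffix (piece 2) (from 3))) valid-Tₚ)
                      (⊆.xs⊆xs++ys _ _ ∘ ⊆.xs⊆xs++ys _ _) place-u))
      (apply sub-r (premise (++-⊆ (Γ₁ ++ Γ₂) Γ₁++Γ₂⊆C λ ())
                      (valid-⊑ (⊑-++⁺ (piece 0 ++ piece 1) (Sublist.minimum _)) valid-Tₚ)
                      (⊆.xs⊆xs++ys _ _ ∘ ⊆.xs⊆xs++ys _ _) place-r))
      (All.++⁺ (piece-<: #0 (All.++⁻ˡ Γ₁ Γ₁++Δ₁<:□)) (piece-<: (#suc (#suc #0)) (All.++⁻ʳ Γ₁ Γ₁++Δ₁<:□)))
      A-free (T↭ , Admissible.valid adm)
    where
    C↭Γ₁Γ₂Δ₁Δ₂ : _ ↭ concat (Γ₁ ∷ Γ₂ ∷ Δ₁ ∷ Δ₂ ∷ [])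
    C↭Γ₁Γ₂Δ₁Δ₂ = ↭-trans C↭ (↭-reflexive (trans (++-assoc Γ₁ Γ₂ _)
                   (cong (λ Δ → Γ₁ ++ Γ₂ ++ Δ₁ ++ Δ) (sym (++-identityʳ Δ₂)))))
    open Split adm Γ₁ (Γ₂ ∷ Δ₁ ∷ Δ₂ ∷ []) (C↭Γ₁Γ₂Δ₁Δ₂ , C-valid)

    T↭ : T ↭ (piece 0 ++ piece 1) ++ piece 2 ++ from 3
    T↭ = ↭-trans (T↭layers 3) (↭-reflexive (sym (++-assoc (piece 0) (piece 1) _)))

    valid-Tₚ : ValidCtx ((piece 0 ++ piece 1) ++ piece 2 ++ from 3)
    valid-Tₚ = valid-↭ T↭ (Admissible.valid adm)

    Γ₁++Γ₂⊆C : Γ₁ ++ Γ₂ ⊆ _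
    Γ₁++Γ₂⊆C = ++-⊆ Γ₁ (block⊆C #0) (block⊆C (#suc #0))

    place-Γ : ∀ {e c} → e ∈ T → c ∈ Γ₁ ++ Γ₂ → label e ≡ blockOf Bs c → e ∈ piece 0 ++ piece 1
    place-Γ e∈T c∈ eq with ∈-++⁻ Γ₁ c∈
    ... | inj₁ c∈Γ₁ = ∈-++⁺ˡ (place-piece #0 e∈T c∈Γ₁ eq)
    ... | inj₂ c∈Γ₂ = ∈-++⁺ʳ (piece 0) (place-piece (#suc #0) e∈T c∈Γ₂ eq)

    place-u : ∀ {e c} → e ∈ T → c ∈ (Γ₁ ++ Γ₂) ++ Δ₂ → label e ≡ blockOf Bs c →
              e ∈ (piece 0 ++ piece 1) ++ from 3
    place-u e∈T c∈ eq with ∈-++⁻ (Γ₁ ++ Γ₂) c∈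
    ... | inj₁ c∈Γ  = ∈-++⁺ˡ (place-Γ e∈T c∈Γ eq)
    ... | inj₂ c∈Δ₂ = ∈-++⁺ʳ (piece 0 ++ piece 1) (place-from (#suc (#suc (#suc #0))) e∈T c∈Δ₂ eq)

    place-r : ∀ {e c} → e ∈ T → c ∈ (Γ₁ ++ Γ₂) ++ [] → label e ≡ blockOf Bs c →
              e ∈ (piece 0 ++ piece 1) ++ []
    place-r e∈T c∈ eq with ∈-++⁻ (Γ₁ ++ Γ₂) c∈
    ... | inj₁ c∈Γ = ∈-++⁺ˡ (place-Γ e∈T c∈Γ eq)

  subst-lam : ∀ {C b A t B} (L : List Var) →
              (∀ y → y ∉ L → Substitutable ((y , b , A) ∷ C) (open[ 0 ↦ fv y ] t) B) →
              Substitutable C (lam b A t) (b ⟨ A ⟩⇒ B)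
  subst-lam {C} {b} {A} {t} {B} L sub-body .apply {T} adm = ⊢lam (x ∷ L ++ dom T ++ dom D) body
    where
    open Admissible adm
    body : ∀ y → y ∉ x ∷ L ++ dom T ++ dom D → ((y , b , A) ∷ T) ⊢ open[ 0 ↦ fv y ] (t [ x := s ]) ∶ B
    body y y∉ = subst (((y , b , A) ∷ T) ⊢_∶ B)
                      (sym (open-subst 0 t (subst-fv-≢ s y≢x) (λ j → open-Closed (fv y) s-closed z≤n)))
                      (apply (sub-body y (y∉ ∘ there ∘ ∈-++⁺ˡ)) adm′)
      where
      y≢x : y ≢ x
      y≢x = y∉ ∘ here
      y∉T : y ∉ dom T
      y∉T = y∉ ∘ there ∘ ∈-++⁺ʳ L ∘ ∈-++⁺ˡ
      y∉D : y ∉ dom D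
      y∉D = y∉ ∘ there ∘ ∈-++⁺ʳ L ∘ ∈-++⁺ʳ (dom T)
      adm′ : Admissible ((y , b , A) ∷ C) ((y , b , A) ∷ T)
      adm′ = record
        { x-unique = λ { (here refl) y≡x → ⊥-elim (y≢x y≡x) ; (there e∈) → x-unique e∈ }
        ; shared-N = λ { (here refl) y∈D _ → ⊥-elim (y∉D (∈-map⁺ proj₁ y∈D)) ; (there e∈) → shared-N e∈ }
        ; valid    = All.¬Any⇒All¬ (dom T) y∉T ∷ valid
        ; keeps    = λ { (here refl) _ → here refl ; (there e∈) e≢x → there (keeps e∈ e≢x) }
        ; receives = λ { (here xa≡) → ⊥-elim (y≢x (sym (cong proj₁ xa≡))) ; (there xa∈) → there ∘ receives xa∈ }
        }

  substitute : ∀ {C t A} → C ⊢ t ∶ A → Substitutable C t A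
  substitute (⊢var {x = y} _ y∈C) .apply {T} adm with y ≟ x
  ... | yes refl = subst (T ⊢ s ∶_) (cong typeOf (sym y≡xa)) (s-weaken valid (receives (subst (_∈ _) y≡xa y∈C)))
    where
    open Admissible adm
    y≡xa = x-unique y∈C refl
  ... | no y≢x   = ⊢var (Admissible.valid adm) (Admissible.keeps adm y∈C y≢x)
  substitute (⊢sub d A<:B) .apply adm = ⊢sub (apply (substitute d) adm) A<:B
  substitute (⊢cst _) .apply adm = ⊢cst (Admissible.valid adm)
  substitute (⊢lam L body) = subst-lam L λ y y∉L → substitute (body y y∉L)
  substitute (⊢case Γ-N d₁ d₂ d₃ d₄ A-free C≅) =
    subst-case Γ-N (substitute d₁) (substitute d₂) (substitute d₃) (substitute d₄) A-free C≅
  substitute (⊢rec Γ₁-N Γ₂-N d₁ d₂ d₃ Γ₁Δ₁<:□ A-free C≅) =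
    subst-rec Γ₁-N Γ₂-N (substitute d₁) (substitute d₂) (substitute d₃) Γ₁Δ₁<:□ A-free C≅
  substitute (⊢app Γ-N d₁ d₂ Γ₂Δ₂<:a C≅) =
    subst-app Γ-N (substitute d₁) (substitute d₂) Γ₂Δ₂<:a C≅

-- Weakening is the substitution of a fresh variable by itself.
⊢-weaken : ∀ {C T t A} → C ⊢ t ∶ A → ValidCtx T → C ⊆ T → T ⊢ t ∶ A
⊢-weaken {C} {T} {t} {A} d T-valid C⊆T = subst (T ⊢_∶ A) (subst-self z t) (apply (substitute d) adm)
  where
  z = proj₁ (fresh (dom C))
  z∉C = proj₂ (fresh (dom C))
  open Substitution z □ N ((z , □ , N) ∷ []) (fv z) (λ v z⊆ → ⊢var v (z⊆ (here refl))) fv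
                    (□<:□ ∷ []) (λ _ → refl ∷ [])
  adm : Admissible C T
  adm = record
    { x-unique = λ e∈ e≡z → ⊥-elim (z∉C (subst (_∈ dom C) e≡z (∈-map⁺ proj₁ e∈)))
    ; shared-N = λ { _ (here refl) z≢z → ⊥-elim (z≢z refl) }
    ; valid    = T-valid
    ; keeps    = λ e∈ _ → C⊆T e∈
    ; receives = λ za∈ → ⊥-elim (z∉C (∈-map⁺ proj₁ za∈))
    }

substitution-numeral : ∀ (Γ Δ Θ : Ctx) (x : Var) (t : Tm) (A : Ty) →
  AllN Γ → Γ ++ Δ ⊢ t ∶ A → Γ ↭ ((x , □ , N) ∷ Θ) →
  ∀ (n : ℕ) → Θ ++ Δ ⊢ t [ x := cst (num n) ] ∶ A
substitution-numeral Γ Δ Θ x t A _ d Γ↭ n = apply (substitute d) adm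
  where
  open Substitution x □ N [] (cst (num n)) (λ v _ → ⊢cst v) cst [] (λ _ → [])
  C↭ : Γ ++ Δ ↭ xa ∷ Θ ++ Δ
  C↭ = ↭.++⁺ʳ Δ Γ↭
  adm : Admissible (Γ ++ Δ) (Θ ++ Δ)
  adm = record
    { x-unique = λ e∈ e≡x → valid-key-injective (⊢-valid d) e∈ (∈-resp-↭ (↭-sym C↭) (here refl)) e≡x
    ; shared-N = λ _ ()
    ; valid    = valid-tail {xa} (valid-↭ C↭ (⊢-valid d))
    ; keeps    = λ e∈ e≢x → ∈-tail (∈-resp-↭ C↭ e∈) e≢x
    ; receives = λ _ ()
    }

substitution-higher-type : ∀ (Γ Δ Θ Ξ : Ctx) (x : Var) (H : Ty) (t s : Tm) (A : Ty) →
  AllN Γ → Γ ++ Δ ⊢ t ∶ A →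
  Δ ↭ ((x , □ , H) ∷ Θ) → H ≢ N →
  Γ ++ Ξ ⊢ s ∶ H → (Γ ++ Ξ) <:ᶜ □ →
  Disjoint (dom Θ) (dom Ξ) →
  Γ ++ (Θ ++ Ξ) ⊢ t [ x := s ] ∶ A
substitution-higher-type Γ Δ Θ Ξ x H t s A Γ-N d Δ↭ H≢N ds ΓΞ<:□ Θ#Ξ = apply (substitute d) adm
  where
  open Substitution x □ H (Γ ++ Ξ) s (⊢-weaken ds) (⊢-Closed ds) ΓΞ<:□ (⊥-elim ∘ H≢N)
  C↭ : Γ ++ Δ ↭ xa ∷ Γ ++ Θ
  C↭ = ↭-trans (↭.++⁺ˡ Γ Δ↭) (shift xa Γ Θ)
  kept : ∀ {e} → e ∈ Γ ++ Δ → key e ≢ x → e ∈ Γ ++ Θ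
  kept e∈ e≢x = ∈-tail (∈-resp-↭ C↭ e∈) e≢x
  shared-N : ∀ {e} → e ∈ Γ ++ Δ → e ∈ Γ ++ Ξ → key e ≢ x → typeOf e ≡ N
  shared-N e∈ΓΔ e∈ΓΞ e≢x with ∈-++⁻ Γ (kept e∈ΓΔ e≢x) | ∈-++⁻ Γ e∈ΓΞ
  ... | inj₁ e∈Γ | _        = All.lookup Γ-N e∈Γ
  ... | _        | inj₁ e∈Γ = All.lookup Γ-N e∈Γ
  ... | inj₂ e∈Θ | inj₂ e∈Ξ = ⊥-elim (Θ#Ξ (∈-map⁺ proj₁ e∈Θ , ∈-map⁺ proj₁ e∈Ξ))
  adm : Admissible (Γ ++ Δ) (Γ ++ (Θ ++ Ξ))
  adm = record
    { x-unique = λ e∈ e≡x → valid-key-injective (⊢-valid d) e∈ (∈-resp-↭ (↭-sym C↭) (here refl)) e≡x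
    ; shared-N = shared-N
    ; valid    = valid-++-++ Γ (valid-tail {xa} (valid-↭ C↭ (⊢-valid d))) (⊢-valid ds) Θ#Ξ
    ; keeps    = λ e∈ e≢x → ⊆.++⁺ʳ Γ (⊆.xs⊆xs++ys Θ Ξ) (kept e∈ e≢x)
    ; receives = λ _ → ⊆.++⁺ʳ Γ (⊆.xs⊆ys++xs Ξ Θ)
    }

mainTheorem13 :
    (∀ (Γ Δ Θ : Ctx) (x : Var) (t : Tm) (A : Ty) →
       AllN Γ → Γ ++ Δ ⊢ t ∶ A →
       Γ ↭ ((x , □ , N) ∷ Θ) →
       ∀ (n : ℕ) → Θ ++ Δ ⊢ t [ x := cst (num n) ] ∶ A)
    ×
    (∀ (Γ Δ Θ Ξ : Ctx) (x : Var) (H : Ty) (t s : Tm) (A : Ty) →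
       AllN Γ → Γ ++ Δ ⊢ t ∶ A →
       Δ ↭ ((x , □ , H) ∷ Θ) → H ≢ N →
       Γ ++ Ξ ⊢ s ∶ H → (Γ ++ Ξ) <:ᶜ □ →
       Disjoint (dom Θ) (dom Ξ) →
       Γ ++ (Θ ++ Ξ) ⊢ t [ x := s ] ∶ A)
mainTheorem13 = substitution-numeral , substitution-higher-type
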